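{- Let $\lambda(G)$ be a temporal graph on an undirected graph $G=(V,E)$ with $n=|V|$ nodes, with connected instances and age $\alpha(\lambda)=n+k$. Let $S\subseteq V$ be a set of source nodes, $k:S\to\mathbb{N}_{\ge1}$ a map with $\sum_{s\in S}k(s)=k$, and $v\in V$ a sink node. Then there are at least $k$ pairwise out-disjoint journeys from $S$ to $v$ such that exactly $k(s_i)$ of these journeys leave from each source node $s_i\in S$.
   Context: A labeling $\lambda:E\to 2^{\mathbb{N}}$ makes $\lambda(G)$ a temporal graph; $\lambda_{\min},\lambda_{\max}$ are the minimum and maximum labels and the age is $\alpha(\lambda)=\lambda_{\max}-\lambda_{\min}+1$. The $t$-th instance is the static graph $\lambda(G,t)=(V,\{e\in E:t\in\lambda(e)\})$. $\lambda(G)$ has connected instances if $\lambda(G,t)$ is connected for every time $t$ with $\lambda_{\min}\le t\le\lambda_{\max}$. A journey is a path $(e_1,\dots,e_k)$ with labels $l_1<\dots<l_k$, $l_i\in\lambda(e_i)$; it leaves node $u$ at time $t$ if it traverses an edge from $u$ using label $t$. Two journeys are out-disjoint if they never leave from the same node at the same time. -}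

module Defs where

open import Data.Nat using (ℕ; zero; suc; _+_; _∸_; _≤_; _<_)
open import Data.Fin using (Fin; toℕ)
open import Data.Bool using (Bool; true; false; if_then_else_)
open import Data.List using (List; []; _∷_)
open import Data.List.Relation.Unary.Unique.Propositional using (Unique)
open import Data.Vec using (Vec; sum; tabulate)
open import Data.Fin.Subset using (Subset; _∈_)
open import Data.Fin.Subset.Properties using (_∈?_)
open import Relation.Nullary.Decidable using (⌊_⌋)
open import Relation.Binary.PropositionalEquality using (_≡_; _≢_)
open import Data.Product using (Σ; ∃; _×_)
open import Relation.Nullary using (¬_)
open import Data.Empty using (⊥)

record Graph (n : ℕ) : Set where
  field
    E       : Fin n → Fin n → Bool
    E-sym   : ∀ u w → E u w ≡ E w u
    E-irr   : ∀ u → E u u ≡ false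
open Graph public

-- A labeling λ : E → 2^ℕ of G, given as: lab u w t ≡ true  iff  t ∈ λ({u,w}).
record Labeling {n : ℕ} (G : Graph n) : Set where
  field
    lab     : Fin n → Fin n → ℕ → Bool
    lab-sym : ∀ u w t → lab u w t ≡ lab w u t
    lab-E   : ∀ u w t → lab u w t ≡ true → E G u w ≡ true
open Labeling public

module _ {n : ℕ} {G : Graph n} (λ' : Labeling G) where

  IsMinLabel : ℕ → Set
  IsMinLabel m = (∃ λ u → ∃ λ w → lab λ' u w m ≡ true)
               × (∀ u w t → lab λ' u w t ≡ true → m ≤ t)

  IsMaxLabel : ℕ → Set
  IsMaxLabel m = (∃ λ u → ∃ λ w → lab λ' u w m ≡ true)
               × (∀ u w t → lab λ' u w t ≡ true → t ≤ m)

  data Reach (t : ℕ) : Fin n → Fin n → Set where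
    here : ∀ {u} → Reach t u u
    step : ∀ {u w x} → lab λ' u w t ≡ true → Reach t w x → Reach t u x

  InstanceConnected : ℕ → Set
  InstanceConnected t = ∀ u w → Reach t u w

  ConnectedInstances : ℕ → ℕ → Set
  ConnectedInstances lmin lmax = ∀ t → lmin ≤ t → t ≤ lmax → InstanceConnected t

  data JWalk (b : ℕ) : Fin n → Fin n → Set where
    stop : ∀ {v} → JWalk b v v
    go   : ∀ {u v} (w : Fin n) (l : ℕ) → b ≤ l → lab λ' u w l ≡ true
         → JWalk (suc l) w v → JWalk b u v

  vertices : ∀ {b u v} → JWalk b u v → List (Fin n)
  vertices {u = u} stop = u ∷ []
  vertices {u = u} (go w l _ _ j) = u ∷ vertices j

  record Journey (u v : Fin n) : Set where
    constructor journey
    field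
      walk : JWalk 0 u v
      path : Unique (vertices walk)
  open Journey public

  data LeavesW : ∀ {b u v} → JWalk b u v → Fin n → ℕ → Set where
    now   : ∀ {b u v w l p q j} → LeavesW {b} {u} {v} (go w l p q j) u l
    later : ∀ {b u v w l p q j x t} → LeavesW j x t
          → LeavesW {b} {u} {v} (go w l p q j) x t

  Leaves : ∀ {u v} → Journey u v → Fin n → ℕ → Set
  Leaves J = LeavesW (walk J)

  OutDisjoint : ∀ {u v u' v'} → Journey u v → Journey u' v' → Set
  OutDisjoint J J' = ∀ x t → Leaves J x t → Leaves J' x t → ⊥

age : ℕ → ℕ → ℕ
age lmin lmax = suc lmax ∸ lmin

sumOver : ∀ {n} → Subset n → (Fin n → ℕ) → ℕ
sumOver S k = sum (tabulate (λ s → if ⌊ s ∈? S ⌋ then k s else 0))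

-- Sweep the time window backwards, keeping at each time t a packing: pairwise out-disjoint
-- walks to v using only labels ≥ t, C y of them starting at each node y. A node y ≠ v demands k(y)
-- walks if it is a source and one otherwise. If at time t some y falls short of its demand,
-- λ(G,t) contains a simple path from y to v; restarted at its last node x holding no walk
-- (or kept if there is none), every later node other than v holds one. Each node of the path
-- then hands its top walk to its predecessor, prefixed by the path edge at time t: all counts
-- are kept except that of x, which grows by one, and the new departures are at distinct nodes
-- at time t. Hence the total unmet demand, at most n + k − 1 initially, drops at every step
-- until all demands are met, and the n + k instances suffice. Loop erasure finally turns the
-- walks into journeys without adding departures.

module Submission where

open import Defs
open import Data.Nat using (ℕ; zero; suc; pred; _+_; _∸_; _≤_; _<_; _<?_; z≤n; s≤s)
  renaming (_≟_ to _≟ℕ_)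
open import Data.Nat.Properties hiding (_≟_)
open import Data.Fin using (Fin; toℕ; zero; suc; _≟_)
open import Data.Fin.Properties using (any?; toℕ<n)
open import Data.Fin.Subset using (Subset; _∈_)
open import Data.Fin.Subset.Properties using (_∈?_)
open import Data.Bool using (true; if_then_else_)
open import Data.Vec as Vec using (tabulate)
open import Data.Vec.Functional.Properties using (updateAt-updates; updateAt-minimal)
open import Data.Vec.Functional using (updateAt)
open import Data.List using (List; []; _∷_)
open import Data.List.Relation.Unary.Any as Any using ()
open import Data.List.Relation.Unary.All.Properties using (¬Any⇒All¬)
open import Data.List.Relation.Unary.All using ([]; _∷_)
open import Data.List.Relation.Unary.AllPairs using ([]; _∷_)
open import Data.List.Relation.Unary.Unique.Propositional using (Unique)
open import Data.List.Relation.Unary.Unique.Propositional.Properties using (Unique[x∷xs]⇒x∉xs)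
import Data.List.Membership.DecPropositional
open import Data.List.Membership.Propositional using () renaming (_∈_ to _∈ₗ_; _∉_ to _∉ₗ_)
open import Data.Maybe using (Maybe; just; nothing)
open import Data.Product using (Σ; ∃; _×_; _,_; proj₁; proj₂)
open import Data.Sum using (_⊎_; inj₁; inj₂)
open import Data.Empty using (⊥; ⊥-elim)
open import Function using (_∘_; case_of_)
open import Relation.Nullary using (¬_; Dec; yes; no)
open import Relation.Nullary.Decidable using (⌊_⌋; ¬?; _×-dec_)
open import Relation.Binary.PropositionalEquality using (_≡_; _≢_; refl; sym; trans; cong; subst)

open import Algebra.Properties.CommutativeMonoid.Sum +-0-commutativeMonoid
  using (∑-distrib-+) renaming (sum to ∑)

updateAt-suc-≥ : ∀ {m} (C : Fin m → ℕ) (x y : Fin m) → C y ≤ updateAt C x suc y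
updateAt-suc-≥ C x y with y ≟ x
... | yes refl = subst (C y ≤_) (sym (updateAt-updates x C)) (n≤1+n (C y))
... | no y≢x = ≤-reflexive (sym (updateAt-minimal y x C y≢x))

pred[n]<n : ∀ {m} → 1 ≤ m → pred m < m
pred[n]<n (s≤s _) = ≤-refl

sum-tabulate : ∀ {m} (f : Fin m → ℕ) → Vec.sum (tabulate f) ≡ ∑ f
sum-tabulate {zero} f = refl
sum-tabulate {suc m} f = cong (f zero +_) (sum-tabulate (f ∘ suc))

∑-ones : ∀ m → ∑ {m} (λ _ → 1) ≡ m
∑-ones zero = refl
∑-ones (suc m) = cong suc (∑-ones m)

∑-mono-≤ : ∀ {m} {f g : Fin m → ℕ} → (∀ x → f x ≤ g x) → ∑ f ≤ ∑ g
∑-mono-≤ {zero} f≤g = z≤n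
∑-mono-≤ {suc m} f≤g = +-mono-≤ (f≤g zero) (∑-mono-≤ (f≤g ∘ suc))

∑-mono-< : ∀ {m} {f g : Fin m → ℕ} (x : Fin m) → (∀ y → f y ≤ g y) → f x < g x → ∑ f < ∑ g
∑-mono-< zero f≤g fx<gx = +-mono-<-≤ fx<gx (∑-mono-≤ (f≤g ∘ suc))
∑-mono-< (suc x) f≤g fx<gx = +-mono-≤-< (f≤g zero) (∑-mono-< x (f≤g ∘ suc) fx<gx)

module _ {n : ℕ} {G : Graph n} (λ' : Labeling G) where

  open Data.List.Membership.DecPropositional (_≟_ {n}) using () renaming (_∈?_ to _∈ₗ?_)

  -- Loop erasure of temporal walks

  OutDisjointW : ∀ {b u w b' u' w'} → JWalk λ' b u w → JWalk λ' b' u' w' → Set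
  OutDisjointW j j' = ∀ {x τ} → LeavesW λ' j x τ → LeavesW λ' j' x τ → ⊥

  _⊆ᴸ_ : ∀ {b u w b' u' w'} → JWalk λ' b u w → JWalk λ' b' u' w' → Set
  j ⊆ᴸ j' = ∀ {x τ} → LeavesW λ' j x τ → LeavesW λ' j' x τ

  leaves-≥ : ∀ {b u w} (j : JWalk λ' b u w) {x τ} → LeavesW λ' j x τ → b ≤ τ
  leaves-≥ (go _ _ b≤l _ _) now = b≤l
  leaves-≥ (go _ _ b≤l _ j) (later h) = ≤-trans b≤l (<⇒≤ (leaves-≥ j h))

  weaken : ∀ {b b' u w} → b ≤ b' → JWalk λ' b' u w → JWalk λ' b u w
  weaken _ stop = stop
  weaken b≤b' (go w l b'≤l e j) = go w l (≤-trans b≤b' b'≤l) e j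

  weaken-vertices : ∀ {b b' u w} (b≤b' : b ≤ b') (j : JWalk λ' b' u w)
                  → vertices λ' (weaken b≤b' j) ≡ vertices λ' j
  weaken-vertices _ stop = refl
  weaken-vertices _ (go _ _ _ _ _) = refl

  weaken-⊆ᴸ : ∀ {b b' u w} (b≤b' : b ≤ b') (j : JWalk λ' b' u w) → weaken b≤b' j ⊆ᴸ j
  weaken-⊆ᴸ _ (go _ _ _ _ _) now = now
  weaken-⊆ᴸ _ (go _ _ _ _ _) (later h) = later h

  SimpleSubwalk : ∀ {b a w} → JWalk λ' b a w → Fin n → Set
  SimpleSubwalk {b} {w = w} j u = Σ (JWalk λ' b u w) λ k → Unique (vertices λ' k) × k ⊆ᴸ j

  narrow : ∀ {b a a' u w} {j : JWalk λ' b a w} {j' : JWalk λ' b a' w}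
         → j' ⊆ᴸ j → SimpleSubwalk j' u → SimpleSubwalk j u
  narrow j'⊆j (k , simple , k⊆j') = k , simple , λ h → j'⊆j (k⊆j' h)

  extendSubwalk : ∀ {b u w' l w x} {b≤l : b ≤ l} {e : lab λ' u w' l ≡ true}
                  {j : JWalk λ' (suc l) w' w}
                → SimpleSubwalk j x → SimpleSubwalk (go w' l b≤l e j) x
  extendSubwalk {b≤l = b≤l} (k , simple , k⊆j) =
    weaken b≤1+l k ,
    subst Unique (sym (weaken-vertices b≤1+l k)) simple ,
    λ h → later (k⊆j (weaken-⊆ᴸ b≤1+l k h))
    where
    b≤1+l : _ ≤ _
    b≤1+l = m≤n⇒m≤1+n b≤l

  suffix : ∀ {b a w u} (j : JWalk λ' b a w) → Unique (vertices λ' j) → u ∈ₗ vertices λ' j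
         → SimpleSubwalk j u
  suffix stop simple (Any.here refl) = stop , simple , λ ()
  suffix (go w l b≤l e j) simple (Any.here refl) = go w l b≤l e j , simple , λ h → h
  suffix (go w l b≤l e j) (_ ∷ simple) (Any.there u∈) = extendSubwalk (suffix j simple u∈)

  loopErase : ∀ {b u w} (j : JWalk λ' b u w) → SimpleSubwalk j u
  loopErase stop = stop , [] ∷ [] , λ ()
  loopErase {u = u} (go w l b≤l e j) with loopErase j
  ... | k , simple , k⊆j with u ∈ₗ? vertices λ' k
  ...   | yes u∈ = extendSubwalk (narrow k⊆j (suffix k simple u∈))
  ...   | no u∉ = go w l b≤l e k , ¬Any⇒All¬ _ u∉ ∷ simple , λ { now → now ; (later h) → later (k⊆j h) }

  journeyOf : ∀ {u w} → JWalk λ' 0 u w → Journey λ' u w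
  journeyOf j = journey (proj₁ (loopErase j)) (proj₁ (proj₂ (loopErase j)))

  journeyOf-⊆ᴸ : ∀ {u w} (j : JWalk λ' 0 u w) → walk (journeyOf j) ⊆ᴸ j
  journeyOf-⊆ᴸ j = proj₂ (proj₂ (loopErase j))

  -- Simple paths in a single instance

  nodes : ∀ {t u x} → Reach λ' t u x → List (Fin n)
  nodes {u = u} here = u ∷ []
  nodes {u = u} (step _ r) = u ∷ nodes r

  laterNodes : ∀ {t u x} → Reach λ' t u x → List (Fin n)
  laterNodes here = []
  laterNodes (step _ r) = nodes r

  laterNodes⊆nodes : ∀ {t u x} (r : Reach λ' t u x) {z} → z ∈ₗ laterNodes r → z ∈ₗ nodes r
  laterNodes⊆nodes (step _ _) z∈ = Any.there z∈

  start∈nodes : ∀ {t u x} (r : Reach λ' t u x) → u ∈ₗ nodes r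
  start∈nodes here = Any.here refl
  start∈nodes (step _ _) = Any.here refl

  end∈nodes : ∀ {t u x} (r : Reach λ' t u x) → x ∈ₗ nodes r
  end∈nodes here = Any.here refl
  end∈nodes (step _ r) = Any.there (end∈nodes r)

  start∉laterNodes : ∀ {t u x} (r : Reach λ' t u x) → Unique (nodes r) → u ∉ₗ laterNodes r
  start∉laterNodes (step _ _) simple = Unique[x∷xs]⇒x∉xs simple

  SimplePath : ℕ → Fin n → Fin n → Set
  SimplePath t u x = Σ (Reach λ' t u x) λ r → Unique (nodes r)

  suffixPath : ∀ {t a u x} (r : Reach λ' t a x) → Unique (nodes r) → u ∈ₗ nodes r → SimplePath t u x
  suffixPath here simple (Any.here refl) = here , simple
  suffixPath (step e r) simple (Any.here refl) = step e r , simple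
  suffixPath (step _ r) (_ ∷ simple) (Any.there u∈) = suffixPath r simple u∈

  simplify : ∀ {t u x} → Reach λ' t u x → SimplePath t u x
  simplify here = here , [] ∷ []
  simplify {u = u} (step e r) with simplify r
  ... | r' , simple with u ∈ₗ? nodes r'
  ...   | yes u∈ = suffixPath r' simple u∈
  ...   | no u∉ = step e r' , ¬Any⇒All¬ _ u∉ ∷ simple

  successor : ∀ {t u x} → Reach λ' t u x → Fin n → Maybe (Fin n)
  successor here _ = nothing
  successor (step {u} {w} _ r) y with y ≟ u
  ... | yes _ = just w
  ... | no _ = successor r y

  successor-edge : ∀ {t u x} (r : Reach λ' t u x) → ∀ {y z} → successor r y ≡ just z → lab λ' y z t ≡ true
  successor-edge (step {u} e r) {y} eq with y ≟ u
  successor-edge (step e r) refl | yes refl = e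
  ... | no _ = successor-edge r eq

  successor-later : ∀ {t u x} (r : Reach λ' t u x) → ∀ {y z} → successor r y ≡ just z → z ∈ₗ laterNodes r
  successor-later (step {u} e r) {y} eq with y ≟ u
  successor-later (step e r) refl | yes _ = start∈nodes r
  ... | no _ = laterNodes⊆nodes r (successor-later r eq)

  successor-defined : ∀ {t u x} (r : Reach λ' t u x) → ∀ {y} → y ∈ₗ nodes r → y ≢ x
                    → ∃ λ z → successor r y ≡ just z
  successor-defined here (Any.here refl) y≢x = ⊥-elim (y≢x refl)
  successor-defined (step {u} {w} e r) {y} y∈ y≢x with y ≟ u
  ... | yes _ = w , refl
  successor-defined (step e r) (Any.here refl) y≢x | no y≢u = ⊥-elim (y≢u refl)
  successor-defined (step e r) (Any.there y∈) y≢x | no _ = successor-defined r y∈ y≢x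

  successor-injective : ∀ {t u x} (r : Reach λ' t u x) → Unique (nodes r)
                      → ∀ {y y' z} → successor r y ≡ just z → successor r y' ≡ just z → y ≡ y'
  successor-injective (step {u} e r) (_ ∷ simple) {y} {y'} eq eq' with y ≟ u | y' ≟ u
  ... | yes y≡u | yes y'≡u = trans y≡u (sym y'≡u)
  successor-injective (step e r) (_ ∷ simple) refl eq' | yes _ | no _ =
    ⊥-elim (start∉laterNodes r simple (successor-later r eq'))
  successor-injective (step e r) (_ ∷ simple) eq refl | no _ | yes _ =
    ⊥-elim (start∉laterNodes r simple (successor-later r eq))
  ... | no _ | no _ = successor-injective r simple eq eq'

  ConnectedFrom : ℕ → ℕ → Set
  ConnectedFrom t m = ∀ τ → t ≤ τ → τ < m + t → InstanceConnected λ' τ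

  ConnectedFrom-head : ∀ {t m} → ConnectedFrom t (suc m) → InstanceConnected λ' t
  ConnectedFrom-head {t} {m} connected = connected t ≤-refl (s≤s (m≤n+m t m))

  ConnectedFrom-tail : ∀ {t m} → ConnectedFrom t (suc m) → ConnectedFrom (suc t) m
  ConnectedFrom-tail {t} {m} connected τ t<τ τ<m+1+t =
    connected τ (<⇒≤ t<τ) (subst (τ <_) (+-suc m t) τ<m+1+t)

  min≤max : ∀ {lmin lmax} → IsMinLabel λ' lmin → IsMaxLabel λ' lmax → lmin ≤ lmax
  min≤max ((u , w , e) , _) (_ , ≤lmax) = ≤lmax u w _ e

  ConnectedInstances⇒ConnectedFrom : ∀ {lmin lmax} → lmin ≤ lmax → ConnectedInstances λ' lmin lmax
                                   → ConnectedFrom lmin (age lmin lmax)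
  ConnectedInstances⇒ConnectedFrom {lmin} {lmax} lmin≤lmax connected τ lmin≤τ τ<age+lmin =
    connected τ lmin≤τ (<⇒≤pred (subst (τ <_) (m∸n+n≡m (m≤n⇒m≤1+n lmin≤lmax)) τ<age+lmin))

  module _ (v : Fin n) where

    -- Packings of out-disjoint walks to v

    record Packing (t : ℕ) (C : Fin n → ℕ) : Set where
      field
        walk     : ∀ y i → i < C y → JWalk λ' t y v
        disjoint : ∀ {y i y' i'} (p : i < C y) (p' : i' < C y') → ¬ (y ≡ y' × i ≡ i')
                 → OutDisjointW (walk y i p) (walk y' i' p')

    emptyPacking : ∀ {t} → Packing t (λ _ → 0)
    emptyPacking = record { walk = λ _ _ () ; disjoint = λ () }

    delay : ∀ {t C} → Packing (suc t) C → Packing t C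
    delay P = record
      { walk     = λ y i p → weaken (n≤1+n _) (P.walk y i p)
      ; disjoint = λ p p' ne l l' → P.disjoint p p' ne (weaken-⊆ᴸ _ _ l) (weaken-⊆ᴸ _ _ l')
      }
      where module P = Packing P

    module _ {t C} (P : Packing t C) where
      private module P = Packing P

      walkOrStop : (y : Fin n) (i : ℕ) → (y ≢ v → i < C y) → JWalk λ' t y v
      walkOrStop y i h with y ≟ v
      ... | yes refl = stop
      ... | no y≢v = P.walk y i (h y≢v)

      walkOrStop-leaves : ∀ y i h {x τ} → LeavesW λ' (walkOrStop y i h) x τ
                        → Σ (y ≢ v) λ y≢v → LeavesW λ' (P.walk y i (h y≢v)) x τ
      walkOrStop-leaves y i h l with y ≟ v
      walkOrStop-leaves .v i h () | yes refl
      ... | no y≢v = y≢v , l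

      walkOrStop-disjoint : ∀ {y i y' i'} h h' → ¬ (y ≡ y' × i ≡ i')
                          → OutDisjointW (walkOrStop y i h) (walkOrStop y' i' h')
      walkOrStop-disjoint h h' ne l l' with walkOrStop-leaves _ _ h l | walkOrStop-leaves _ _ h' l'
      ... | _ , l₁ | _ , l₁' = P.disjoint _ _ ne l₁ l₁'

      packedJourney : (y : Fin n) (i : ℕ) → (y ≢ v → i < C y) → Journey λ' y v
      packedJourney y i h = journeyOf (weaken z≤n (walkOrStop y i h))

      packedJourney-disjoint : ∀ {y i y' i'} h h' → ¬ (y ≡ y' × i ≡ i')
                             → OutDisjoint λ' (packedJourney y i h) (packedJourney y' i' h')
      packedJourney-disjoint h h' ne _ _ l l' =
        walkOrStop-disjoint h h' ne (weaken-⊆ᴸ z≤n _ (journeyOf-⊆ᴸ _ l)) (weaken-⊆ᴸ z≤n _ (journeyOf-⊆ᴸ _ l'))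

    -- Models the successor function of a simple path from the source to v in λ(G,t) whose
    -- later nodes other than v each hold a walk.
    record Chain (t : ℕ) (C : Fin n → ℕ) : Set where
      field
        source         : Fin n
        next           : Fin n → Maybe (Fin n)
        source-moves   : ∃ λ z → next source ≡ just z
        next-edge      : ∀ {y z} → next y ≡ just z → lab λ' y z t ≡ true
        next-injective : ∀ {y y' z} → next y ≡ just z → next y' ≡ just z → y ≡ y'
        next≢source    : ∀ {y z} → next y ≡ just z → z ≢ source
        next-relays    : ∀ {y z} → next y ≡ just z → z ≢ v → 1 ≤ C z × ∃ λ z' → next z ≡ just z'

    module Shift {t C} (P : Packing (suc t) C) (ch : Chain t C) where
      open Chain ch
      private module P = Packing P

      C' : Fin n → ℕ
      C' = updateAt C source suc

      top : Fin n → ℕ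
      top y = pred (C' y)

      C'≡C : ∀ {y} → y ≢ source → C' y ≡ C y
      C'≡C y≢s = updateAt-minimal _ source C y≢s

      top≤C : ∀ y → top y ≤ C y
      top≤C y with y ≟ source
      ... | yes refl = ≤-reflexive (cong pred (updateAt-updates source C))
      ... | no y≢s = ≤-trans pred[n]≤n (≤-reflexive (C'≡C y≢s))

      stuck⇒≢source : ∀ {y} → next y ≡ nothing → y ≢ source
      stuck⇒≢source stuck refl with source-moves
      ... | _ , moves with () ← trans (sym moves) stuck

      data Fate (y : Fin n) (i : ℕ) : Set where
        departs : ∀ {z} → next y ≡ just z → i ≡ top y → Fate y i
        stays   : i < C y → (∀ {z} → next y ≡ just z → i ≢ top y) → Fate y i

      fate : ∀ y i → i < C' y → Fate y i
      fate y i i<C'y with i ≟ℕ top y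
      ... | no i≢top = stays (<-≤-trans (≤∧≢⇒< (<⇒≤pred i<C'y) i≢top) (top≤C y)) (λ _ → i≢top)
      ... | yes i≡top with next y in eq
      ...   | just _ = departs eq i≡top
      ...   | nothing =
        stays (subst (i <_) (C'≡C (stuck⇒≢source eq)) i<C'y) λ e → case trans (sym e) eq of λ ()

      follow : ∀ {y z} → next y ≡ just z → JWalk λ' (suc t) z v
      follow {z = z} e = walkOrStop P z (pred (C z)) (λ z≢v → pred[n]<n (proj₁ (next-relays e z≢v)))

      reroute : ∀ {y i} → Fate y i → JWalk λ' t y v
      reroute (departs e _) = go _ t ≤-refl (next-edge e) (follow e)
      reroute {y} {i} (stays i<C _) = weaken (n≤1+n t) (P.walk y i i<C)

      notNow : ∀ {u x} (j : JWalk λ' (suc t) u v) → ¬ LeavesW λ' j x t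
      notNow j l = 1+n≰n (leaves-≥ j l)

      departs-stays-disjoint : ∀ {y i y' i' z} (e : next y ≡ just z) (i≡top : i ≡ top y)
                               (i'<C : i' < C y') (i'≢top : ∀ {z'} → next y' ≡ just z' → i' ≢ top y')
                             → OutDisjointW (reroute (departs e i≡top)) (reroute (stays i'<C i'≢top))
      departs-stays-disjoint _ _ i'<C _ now l' = notNow (P.walk _ _ i'<C) (weaken-⊆ᴸ _ _ l')
      departs-stays-disjoint {y' = y'} {i'} {z} e _ i'<C i'≢top (later l) l'
        with walkOrStop-leaves P z _ _ l
      ... | z≢v , l₁ = P.disjoint _ i'<C distinct l₁ (weaken-⊆ᴸ _ _ l')
        where
        distinct : ¬ (z ≡ y' × pred (C z) ≡ i')
        distinct (refl , top≡i') = i'≢top (proj₂ (proj₂ (next-relays e z≢v)))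
          (trans (sym top≡i') (cong pred (sym (C'≡C (next≢source e)))))

      reroute-disjoint : ∀ {y i y' i'} (f : Fate y i) (f' : Fate y' i') → ¬ (y ≡ y' × i ≡ i')
                     → OutDisjointW (reroute f) (reroute f')
      reroute-disjoint (departs _ i≡top) (departs _ i'≡top) ne now now = ne (refl , trans i≡top (sym i'≡top))
      reroute-disjoint (departs _ _) (departs e' _) _ now (later l') = notNow (follow e') l'
      reroute-disjoint (departs e _) (departs _ _) _ (later l) now = notNow (follow e) l
      reroute-disjoint (departs {z} e i≡top) (departs {z'} e' i'≡top) ne (later l) (later l') =
        walkOrStop-disjoint P _ _ distinct l l'
        where
        distinct : ¬ (z ≡ z' × pred (C z) ≡ pred (C z'))
        distinct (refl , _) with refl ← next-injective e e' = ne (refl , trans i≡top (sym i'≡top))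
      reroute-disjoint (departs e i≡top) (stays i'<C i'≢top) _ = departs-stays-disjoint e i≡top i'<C i'≢top
      reroute-disjoint (stays i<C i≢top) (departs e' i'≡top) _ l l' =
        departs-stays-disjoint e' i'≡top i<C i≢top l' l
      reroute-disjoint (stays i<C _) (stays i'<C _) ne l l' =
        P.disjoint i<C i'<C ne (weaken-⊆ᴸ _ _ l) (weaken-⊆ᴸ _ _ l')

      shifted : Packing t C'
      shifted = record
        { walk     = λ y i p → reroute (fate y i p)
        ; disjoint = λ p p' → reroute-disjoint (fate _ _ p) (fate _ _ p')
        }

    shift : ∀ {t C} → Packing (suc t) C → (ch : Chain t C) → Packing t (updateAt C (Chain.source ch) suc)
    shift = Shift.shifted

    InteriorPositive : ∀ {t u} → (Fin n → ℕ) → Reach λ' t u v → Set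
    InteriorPositive C r = ∀ {z} → z ∈ₗ laterNodes r → z ≢ v → 1 ≤ C z

    chainAlong : ∀ {t x C} (r : Reach λ' t x v) → Unique (nodes r) → x ≢ v → InteriorPositive C r
               → Chain t C
    chainAlong {x = x} r simple x≢v positive = record
      { source         = x
      ; next           = successor r
      ; source-moves   = successor-defined r (start∈nodes r) x≢v
      ; next-edge      = successor-edge r
      ; next-injective = successor-injective r simple
      ; next≢source    = λ e z≡x →
                           start∉laterNodes r simple (subst (_∈ₗ laterNodes r) z≡x (successor-later r e))
      ; next-relays    = λ e z≢v → positive (successor-later r e) z≢v
                                 , successor-defined r (laterNodes⊆nodes r (successor-later r e)) z≢v
      }

    -- Meeting the demands

    module Saturation (g : Fin n → ℕ) (g-pos : ∀ x → 1 ≤ g x) where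

      Deficient : (Fin n → ℕ) → Fin n → Set
      Deficient C x = x ≢ v × C x < g x

      deficient? : ∀ C x → Dec (Deficient C x)
      deficient? C x = ¬? (x ≟ v) ×-dec (C x <? g x)

      Saturated : (Fin n → ℕ) → Set
      Saturated C = ∀ x → x ≢ v → g x ≤ C x

      deficit : (Fin n → ℕ) → Fin n → ℕ
      deficit C x with x ≟ v
      ... | yes _ = 0
      ... | no _ = g x ∸ C x

      potential : (Fin n → ℕ) → ℕ
      potential C = ∑ (deficit C)

      potential-decreases : ∀ {C x} → Deficient C x → potential (updateAt C x suc) < potential C
      potential-decreases {C} {x} (x≢v , Cx<gx) = ∑-mono-< x deficit-mono deficit-drops
        where
        deficit-mono : ∀ y → deficit (updateAt C x suc) y ≤ deficit C y
        deficit-mono y with y ≟ v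
        ... | yes _ = z≤n
        ... | no _ = ∸-monoʳ-≤ (g y) (updateAt-suc-≥ C x y)
        deficit-drops : deficit (updateAt C x suc) x < deficit C x
        deficit-drops with x ≟ v
        ... | yes x≡v = ⊥-elim (x≢v x≡v)
        ... | no _ = subst (λ c → g x ∸ c < g x ∸ C x) (sym (updateAt-updates x C))
                           (∸-monoʳ-< (n<1+n (C x)) Cx<gx)

      potential₀<n+∑ : ∀ {f} → (∀ x → g x ≤ 1 + f x) → potential (λ _ → 0) < n + ∑ f
      potential₀<n+∑ {f} g≤1+f = begin-strict
        potential (λ _ → 0)   <⟨ ∑-mono-< v bound at-v ⟩
        ∑ (λ x → 1 + f x)     ≡⟨ ∑-distrib-+ (λ _ → 1) f ⟩
        ∑ {n} (λ _ → 1) + ∑ f ≡⟨ cong (_+ ∑ f) (∑-ones n) ⟩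
        n + ∑ f               ∎
        where
        open ≤-Reasoning
        bound : ∀ x → deficit (λ _ → 0) x ≤ 1 + f x
        bound x with x ≟ v
        ... | yes _ = z≤n
        ... | no _ = g≤1+f x
        at-v : deficit (λ _ → 0) v < 1 + f v
        at-v with v ≟ v
        ... | yes _ = s≤s z≤n
        ... | no v≢v = ⊥-elim (v≢v refl)

      record DeficientRoute (t : ℕ) (C : Fin n → ℕ) : Set where
        field
          source    : Fin n
          deficient : Deficient C source
          route     : Reach λ' t source v
          simple    : Unique (nodes route)
          interior  : InteriorPositive C route

      lastEmpty : ∀ {t u C} (r : Reach λ' t u v) → Unique (nodes r)
                → DeficientRoute t C ⊎ (∀ {z} → z ∈ₗ nodes r → z ≢ v → 1 ≤ C z)
      lastEmpty here _ = inj₂ λ { (Any.here refl) v≢v → ⊥-elim (v≢v refl) }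
      lastEmpty {u = u} {C} (step e r) simple@(_ ∷ simple') with lastEmpty r simple'
      ... | inj₁ found = inj₁ found
      ... | inj₂ positive with C u ≟ℕ 0
      ...   | yes Cu≡0 = inj₁ record
        { source    = u
        ; deficient = u≢v , subst (_< g u) (sym Cu≡0) (g-pos u)
        ; route     = step e r
        ; simple    = simple
        ; interior  = positive
        }
        where
        u≢v : u ≢ v
        u≢v refl = Unique[x∷xs]⇒x∉xs simple (end∈nodes r)
      ...   | no Cu≢0 = inj₂ λ { (Any.here refl) _ → n≢0⇒n>0 Cu≢0 ; (Any.there z∈) z≢v → positive z∈ z≢v }

      deficientRoute : ∀ {t C y} → Deficient C y → Reach λ' t y v → DeficientRoute t C
      deficientRoute {y = y} y-deficient r with simplify r
      ... | r' , simple with lastEmpty r' simple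
      ...   | inj₁ found = found
      ...   | inj₂ positive = record
        { source    = y
        ; deficient = y-deficient
        ; route     = r'
        ; simple    = simple
        ; interior  = λ z∈ → positive (laterNodes⊆nodes r' z∈)
        }

      Progress : ℕ → (Fin n → ℕ) → Set
      Progress m C = potential C + m ≤ potential (λ _ → 0) ⊎ Saturated C

      progress-step : ∀ {m C x} → Deficient C x → Progress m C → Progress (suc m) (updateAt C x suc)
      progress-step {m} {C} {x} x-deficient (inj₁ bound) = inj₁ (begin
        potential (updateAt C x suc) + suc m   ≡⟨ +-suc _ m ⟩
        suc (potential (updateAt C x suc) + m) ≤⟨ +-monoˡ-≤ m (potential-decreases x-deficient) ⟩
        potential C + m                        ≤⟨ bound ⟩
        potential (λ _ → 0)                    ∎)
        where open ≤-Reasoning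
      progress-step (x≢v , Cx<gx) (inj₂ saturated) = ⊥-elim (<⇒≱ Cx<gx (saturated _ x≢v))

      saturate : ∀ m t → ConnectedFrom t m → Σ (Fin n → ℕ) λ C → Packing t C × Progress m C
      saturate zero _ _ = (λ _ → 0) , emptyPacking , inj₁ (≤-reflexive (+-identityʳ _))
      saturate (suc m) t connected with saturate m (suc t) (ConnectedFrom-tail connected)
      ... | C , P , progress with any? (deficient? C)
      ...   | no none = C , delay P , inj₂ λ x x≢v → ≮⇒≥ λ Cx<gx → none (x , x≢v , Cx<gx)
      ...   | yes (y , y-deficient) =
        updateAt C source suc ,
        shift P (chainAlong route simple (proj₁ deficient) interior) ,
        progress-step deficient progress
        where open DeficientRoute (deficientRoute {C = C} y-deficient (ConnectedFrom-head connected y v))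

      saturatedPacking : ∀ {m t} → potential (λ _ → 0) < m → ConnectedFrom t m
                       → Σ (Fin n → ℕ) λ C → Packing t C × Saturated C
      saturatedPacking {m} potential<m connected with saturate m _ connected
      ... | C , P , inj₂ saturated = C , P , saturated
      ... | C , P , inj₁ bound = ⊥-elim (<⇒≱ potential<m (≤-trans (m≤n+m m (potential C)) bound))

module Demand {n : ℕ} (S : Subset n) (kf : Fin n → ℕ) where

  demand : Fin n → ℕ
  demand x = if ⌊ x ∈? S ⌋ then kf x else 1

  restricted : Fin n → ℕ
  restricted x = if ⌊ x ∈? S ⌋ then kf x else 0

  demand-positive : (∀ s → s ∈ S → 1 ≤ kf s) → ∀ x → 1 ≤ demand x
  demand-positive kf-pos x with x ∈? S
  ... | yes x∈S = kf-pos x x∈S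
  ... | no _ = ≤-refl

  demand-source : ∀ {s} → s ∈ S → demand s ≡ kf s
  demand-source {s} s∈S with s ∈? S
  ... | yes _ = refl
  ... | no s∉S = ⊥-elim (s∉S s∈S)

  demand≤1+restricted : ∀ x → demand x ≤ 1 + restricted x
  demand≤1+restricted x with x ∈? S
  ... | yes _ = n≤1+n (kf x)
  ... | no _ = ≤-refl

  sumOver≡∑restricted : sumOver S kf ≡ ∑ restricted
  sumOver≡∑restricted = sum-tabulate restricted

lemma2 : (n k : ℕ) (G : Graph n) (λ' : Labeling G) (lmin lmax : ℕ)
    → IsMinLabel λ' lmin → IsMaxLabel λ' lmax
    → ConnectedInstances λ' lmin lmax
    → age lmin lmax ≡ n + k
    → (S : Subset n) (kf : Fin n → ℕ)
    → (∀ s → s ∈ S → 1 ≤ kf s)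
    → sumOver S kf ≡ k
    → (v : Fin n)
    → Σ ((s : Fin n) → s ∈ S → (i : Fin (kf s)) → Journey λ' s v) (λ J →
        ∀ s p i s' p' i' → ¬ (s ≡ s' × toℕ i ≡ toℕ i')
          → OutDisjoint λ' (J s p i) (J s' p' i'))
lemma2 n k G λ' lmin lmax minLabel maxLabel connected age≡n+k S kf kf-pos sum≡k v =
  (λ s s∈S i → packedJourney λ' v P s (toℕ i) (enough s∈S i)) ,
  (λ _ _ _ _ _ _ distinct → packedJourney-disjoint λ' v P _ _ distinct)
  where
  open Demand S kf
  open Saturation λ' v demand (demand-positive kf-pos)

  potential₀<n+k : potential (λ _ → 0) < n + k
  potential₀<n+k = subst (λ m → potential (λ _ → 0) < n + m) (trans (sym sumOver≡∑restricted) sum≡k)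
                         (potential₀<n+∑ demand≤1+restricted)

  connectedFrom : ConnectedFrom λ' lmin (n + k)
  connectedFrom = subst (ConnectedFrom λ' lmin) age≡n+k
                        (ConnectedInstances⇒ConnectedFrom λ' (min≤max λ' minLabel maxLabel) connected)

  packing : Σ (Fin n → ℕ) λ C → Packing λ' v lmin C × Saturated C
  packing = saturatedPacking potential₀<n+k connectedFrom

  C : Fin n → ℕ
  C = proj₁ packing

  P : Packing λ' v lmin C
  P = proj₁ (proj₂ packing)

  enough : ∀ {s} → s ∈ S → (i : Fin (kf s)) → s ≢ v → toℕ i < C s
  enough {s} s∈S i s≢v =
    <-≤-trans (toℕ<n i) (subst (_≤ C s) (demand-source s∈S) (proj₂ (proj₂ packing) s s≢v))
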